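{- Let $\Omega$ be a set of orderings, let $x$ and $y$ be two distinct initial elements of $\Omega$, and let $i$ be an integer. Then $f_{x,y}(i,i+1)=f_{x,y}(i+1,i)$.
   Context: A set of orderings $\Omega$ on a finite set $S$ of $n$ elements is a nonempty set of total orderings of $S$. The rank of an element in an ordering is its position, the first position being $1$. For distinct elements $x,y$ and integers $i,j$, $f_{x,y}(i,j)$ is the probability that, in an ordering chosen uniformly at random from $\Omega$, $x$ has rank $i$ and $y$ has rank $j$. An element $x$ is initial if, in any ordering of $\Omega$ in which $x$ is not the first element, swapping $x$ with its immediate predecessor produces another ordering of $\Omega$. -}

module Defs where

open import Data.Nat using (ℕ; zero; suc)
open import Data.Bool using (Bool; true; false; _∧_)
open import Data.Fin using (Fin; toℕ)
import Data.Fin as Fin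
open import Data.Integer using (ℤ; +_)
import Data.Integer as ℤ
open import Data.Vec using (Vec; lookup; _[_]≔_)
open import Data.List using (List; filter; length)
open import Data.List.NonEmpty using (List⁺; toList)
import Data.List.NonEmpty as List⁺
open import Data.List.Membership.Propositional using (_∈_)
open import Data.List.Relation.Unary.All using (All)
open import Data.List.Relation.Unary.Any using (any?)
open import Data.List.Relation.Unary.Unique.Propositional using (Unique)
open import Data.Product using (_×_)
open import Data.Rational using (ℚ; _/_)
open import Relation.Binary.PropositionalEquality using (_≡_)
open import Relation.Nullary using (Dec; does)
open import Relation.Nullary.Decidable using (_×-dec_)

-- The ground set S with n elements is Fin n.
-- A total ordering of S is a vector listing the elements of S in order,
-- without repetition (hence every element appears exactly once).
-- Position k : Fin n corresponds to rank (toℕ k + 1).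
Ordering : ℕ → Set
Ordering n = Vec (Fin n) n

IsOrdering : ∀ {n} → Ordering n → Set
IsOrdering {n} σ = Unique (Data.Vec.toList σ)

record OrderingSet (n : ℕ) : Set where
  field
    elems     : List⁺ (Ordering n)
    distinct  : Unique (toList elems)
    orderings : All IsOrdering (toList elems)
open OrderingSet public

hasRanks? : ∀ {n} (x y : Fin n) (i j : ℤ) (σ : Ordering n) →
            Dec (Data.List.Relation.Unary.Any.Any (λ k → (+ suc (toℕ k) ≡ i) × (lookup σ k ≡ x)) (Data.List.allFin n)
                 × Data.List.Relation.Unary.Any.Any (λ k → (+ suc (toℕ k) ≡ j) × (lookup σ k ≡ y)) (Data.List.allFin n))
hasRanks? x y i j σ =
  any? (λ k → (+ suc (toℕ k) ℤ.≟ i) ×-dec (lookup σ k Fin.≟ x)) (Data.List.allFin _)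
  ×-dec
  any? (λ k → (+ suc (toℕ k) ℤ.≟ j) ×-dec (lookup σ k Fin.≟ y)) (Data.List.allFin _)

-- f_{x,y}(i,j): probability that, for σ uniform in Ω, x has rank i and y rank j.
f : ∀ {n} (Ω : OrderingSet n) (x y : Fin n) (i j : ℤ) → ℚ
f Ω x y i j =
  (+ length (filter (hasRanks? x y i j) (toList (elems Ω)))) / List⁺.length (elems Ω)

-- x is initial: in every σ ∈ Ω where x is at position p > 0 (rank ≥ 2),
-- swapping x with its immediate predecessor (position q, toℕ q + 1 = toℕ p)
-- gives an ordering in Ω.
Initial : ∀ {n} → OrderingSet n → Fin n → Set
Initial {n} Ω x =
  ∀ (σ : Ordering n) → σ ∈ toList (elems Ω) →
  ∀ (p q : Fin n) → lookup σ p ≡ x → suc (toℕ q) ≡ toℕ p →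
  ((σ [ q ]≔ x) [ p ]≔ lookup σ q) ∈ toList (elems Ω)

module Submission where

-- Fix positions p, q with rank(p) = i and rank(q) = i + 1.
-- Exchanging the entries at two positions is an involution on vectors,
-- hence injective.  If v is initial and σ ∈ Ω has u at rank i and v at
-- rank i + 1, then v is preceded by u, so exchanging p and q keeps σ in Ω
-- and produces an ordering with v at rank i and u at rank i + 1.  An
-- injection between the two filtered sublists of the duplicate-free list
-- Ω bounds their lengths:
--   #{u at i, v at i+1} ≤ #{v at i, u at i+1}          (v initial).
-- Applying this once to (x, y) and once to (y, x) gives the two
-- inequalities whose combination is f_{x,y}(i,i+1) = f_{x,y}(i+1,i).

open import Defs
open import Level using (Level)
open import Data.Nat using (ℕ; suc; _≤_; z≤n; s≤s)
import Data.Nat as ℕ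
import Data.Nat.Properties as ℕP
open import Data.Fin using (Fin; toℕ)
import Data.Fin.Properties as FinP
open import Data.Integer using (ℤ; _+_; +_)
import Data.Integer.Properties as ℤP
open import Data.Vec using (Vec; lookup; _[_]≔_)
import Data.Vec.Properties as VecP
open import Data.List using (List; []; _∷_; _++_; map; filter; length; allFin)
import Data.List.Properties as ListP
open import Data.List.NonEmpty using (toList)
import Data.List.NonEmpty as List⁺
open import Data.List.Membership.Propositional using (_∈_)
open import Data.List.Membership.Propositional.Properties
  using (∈-∃++; ∈-++⁻; ∈-++⁺ˡ; ∈-++⁺ʳ; ∈-filter⁺; ∈-filter⁻; ∈-map⁻; ∈-allFin)
import Data.List.Relation.Unary.All as All
open import Data.List.Relation.Unary.Any using (Any; here; there; satisfied)
import Data.List.Relation.Unary.Any as Any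
open import Data.List.Relation.Unary.Unique.Propositional using (Unique)
import Data.List.Relation.Unary.Unique.Propositional.Properties as UniqueP
open import Data.List.Relation.Unary.AllPairs using (_∷_)
open import Data.Product using (_×_; _,_)
import Data.Product as Product
open import Data.Sum using (inj₁; inj₂)
open import Data.Rational using (_/_)
open import Data.Empty using (⊥-elim)
open import Relation.Binary.PropositionalEquality
open import Relation.Nullary using (¬_)
open import Relation.Unary using (Pred; Decidable)

private
  variable
    a : Level
    A : Set a
    n : ℕ

-- Exchanging the entries at positions p and q of a vector.  The shape is
-- exactly the one produced by the definition of an initial element.
swapAt : Fin n → Fin n → Vec A n → Vec A n
swapAt p q σ = (σ [ q ]≔ lookup σ p) [ p ]≔ lookup σ q

lookup-swapAtˡ : ∀ (p q : Fin n) (σ : Vec A n) → lookup (swapAt p q σ) p ≡ lookup σ q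
lookup-swapAtˡ p q σ = VecP.lookup∘update p (σ [ q ]≔ lookup σ p) (lookup σ q)

lookup-swapAtʳ : ∀ {p q : Fin n} → p ≢ q → (σ : Vec A n) →
                 lookup (swapAt p q σ) q ≡ lookup σ p
lookup-swapAtʳ {p = p} {q} p≢q σ =
  trans (VecP.lookup∘update′ (≢-sym p≢q) (σ [ q ]≔ lookup σ p) (lookup σ q))
        (VecP.lookup∘update q σ (lookup σ p))

swapAt-involutive : ∀ {p q : Fin n} → p ≢ q → (σ : Vec A n) →
                    swapAt p q (swapAt p q σ) ≡ σ
swapAt-involutive {p = p} {q} p≢q σ = begin
  (τ [ q ]≔ lookup τ p) [ p ]≔ lookup τ q
    ≡⟨ cong₂ (λ s t → (τ [ q ]≔ s) [ p ]≔ t) (lookup-swapAtˡ p q σ) (lookup-swapAtʳ p≢q σ) ⟩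
  (((σ [ q ]≔ σp) [ p ]≔ σq) [ q ]≔ σq) [ p ]≔ σp
    ≡⟨ cong (_[ p ]≔ σp) (VecP.[]≔-commutes (σ [ q ]≔ σp) p q p≢q) ⟩
  (((σ [ q ]≔ σp) [ q ]≔ σq) [ p ]≔ σq) [ p ]≔ σp
    ≡⟨ VecP.[]≔-idempotent ((σ [ q ]≔ σp) [ q ]≔ σq) p ⟩
  ((σ [ q ]≔ σp) [ q ]≔ σq) [ p ]≔ σp
    ≡⟨ cong (_[ p ]≔ σp) (VecP.[]≔-idempotent σ q) ⟩
  (σ [ q ]≔ σq) [ p ]≔ σp
    ≡⟨ cong (_[ p ]≔ σp) (VecP.[]≔-lookup σ q) ⟩
  σ [ p ]≔ σp
    ≡⟨ VecP.[]≔-lookup σ p ⟩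
  σ ∎
  where
  open ≡-Reasoning
  σp = lookup σ p
  σq = lookup σ q
  τ  = swapAt p q σ

swapAt-injective : ∀ {p q : Fin n} → p ≢ q → {σ τ : Vec A n} →
                   swapAt p q σ ≡ swapAt p q τ → σ ≡ τ
swapAt-injective p≢q {σ} {τ} eq =
  trans (sym (swapAt-involutive p≢q σ))
        (trans (cong (swapAt _ _) eq) (swapAt-involutive p≢q τ))

unique-⊆-length : {xs ys : List A} → Unique xs →
                  (∀ {z} → z ∈ xs → z ∈ ys) → length xs ≤ length ys
unique-⊆-length {xs = []} _ _ = z≤n
unique-⊆-length {xs = x ∷ xs} (x∉xs ∷ uxs) sub with ∈-∃++ (sub (here refl))
... | us , vs , refl = begin
  suc (length xs)                ≤⟨ s≤s (unique-⊆-length uxs sub′) ⟩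
  suc (length (us ++ vs))        ≡⟨ cong suc (ListP.length-++ us) ⟩
  suc (length us ℕ.+ length vs)  ≡⟨ sym (ℕP.+-suc (length us) (length vs)) ⟩
  length us ℕ.+ suc (length vs)  ≡⟨ sym (ListP.length-++ us) ⟩
  length (us ++ x ∷ vs)          ∎
  where
  open ℕP.≤-Reasoning
  -- x occurs in xs nowhere, so dropping it from ys loses no element of xs.
  sub′ : ∀ {z} → z ∈ xs → z ∈ us ++ vs
  sub′ z∈xs with ∈-++⁻ us (sub (there z∈xs))
  ... | inj₁ z∈us         = ∈-++⁺ˡ z∈us
  ... | inj₂ (here refl)  = ⊥-elim (All.lookup x∉xs z∈xs refl)
  ... | inj₂ (there z∈vs) = ∈-++⁺ʳ us z∈vs

filter-length-≤-injection :
  {P Q : Pred A a} (P? : Decidable P) (Q? : Decidable Q) {L : List A} →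
  Unique L → (g : A → A) → (∀ {σ τ} → g σ ≡ g τ → σ ≡ τ) →
  (∀ {σ} → σ ∈ L → P σ → g σ ∈ L × Q (g σ)) →
  length (filter P? L) ≤ length (filter Q? L)
filter-length-≤-injection P? Q? {L} uL g g-inj maps = begin
  length (filter P? L)           ≡⟨ sym (ListP.length-map g (filter P? L)) ⟩
  length (map g (filter P? L))   ≤⟨ unique-⊆-length image-unique image-⊆ ⟩
  length (filter Q? L)           ∎
  where
  open ℕP.≤-Reasoning
  image-unique : Unique (map g (filter P? L))
  image-unique = UniqueP.map⁺ g-inj (UniqueP.filter⁺ P? uL)
  image-⊆ : ∀ {τ} → τ ∈ map g (filter P? L) → τ ∈ filter Q? L
  image-⊆ τ∈ with ∈-map⁻ g τ∈
  ... | σ , σ∈ , refl with ∈-filter⁻ P? σ∈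
  ...   | σ∈L , Pσ = Product.uncurry (∈-filter⁺ Q?) (maps σ∈L Pσ)

filter-length-≤-from-witness :
  {P : Pred A a} (P? : Decidable P) (L : List A) {m : ℕ} →
  (∀ {σ} → σ ∈ L → P σ → length (filter P? L) ≤ m) →
  length (filter P? L) ≤ m
filter-length-≤-from-witness P? L bound with filter P? L in eq
... | []    = z≤n
... | σ ∷ _ = Product.uncurry bound (∈-filter⁻ P? (subst (σ ∈_) (sym eq) (here refl)))

count : (Ω : OrderingSet n) {P : Pred (Ordering n) Level.zero} → Decidable P → ℕ
count Ω P? = length (filter P? (toList (elems Ω)))

HasRank : Ordering n → Fin n → ℤ → Set
HasRank {n} σ u r = Any (λ k → (+ suc (toℕ k) ≡ r) × (lookup σ k ≡ u)) (allFin n)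

hasRank-intro : ∀ (σ : Ordering n) (k : Fin n) {u r} → + suc (toℕ k) ≡ r → lookup σ k ≡ u →
                HasRank σ u r
hasRank-intro σ k rank-k σk≡u = Any.map (λ { refl → rank-k , σk≡u }) (∈-allFin k)

rank-injective : ∀ {k l : Fin n} → + suc (toℕ k) ≡ + suc (toℕ l) → k ≡ l
rank-injective eq = FinP.toℕ-injective (ℕP.suc-injective (ℤP.+-injective eq))

consecutive-ranks : ∀ {k l : Fin n} {i : ℤ} →
                    + suc (toℕ k) ≡ i → + suc (toℕ l) ≡ i + + 1 → suc (toℕ k) ≡ toℕ l
consecutive-ranks {k = k} refl rank-l =
  sym (trans (ℕP.suc-injective (ℤP.+-injective rank-l)) (ℕP.+-comm (toℕ k) 1))

initial-swap : ∀ (Ω : OrderingSet n) {v} → Initial Ω v →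
               ∀ {σ} → σ ∈ toList (elems Ω) → ∀ {p q} →
               lookup σ q ≡ v → suc (toℕ p) ≡ toℕ q →
               swapAt q p σ ∈ toList (elems Ω)
initial-swap Ω initial {σ} σ∈ {p} {q} σq≡v adjacent =
  subst (λ w → ((σ [ p ]≔ w) [ q ]≔ lookup σ p) ∈ toList (elems Ω)) (sym σq≡v)
        (initial σ σ∈ q p σq≡v adjacent)

exchange-≤ : (Ω : OrderingSet n) (u v : Fin n) → Initial Ω v → (i : ℤ) →
             count Ω (hasRanks? u v i (i + + 1)) ≤ count Ω (hasRanks? v u i (i + + 1))
exchange-≤ Ω u v v-initial i =
  filter-length-≤-from-witness (hasRanks? u v i (i + + 1)) (toList (elems Ω)) bound
  where
  bound : ∀ {σ₀} → σ₀ ∈ toList (elems Ω) → HasRank σ₀ u i × HasRank σ₀ v (i + + 1) →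
          count Ω (hasRanks? u v i (i + + 1)) ≤ count Ω (hasRanks? v u i (i + + 1))
  bound _ (u-rank , v-rank) with satisfied u-rank | satisfied v-rank
  ... | p , rank-p , _ | q , rank-q , _ =
    filter-length-≤-injection (hasRanks? u v i (i + + 1)) (hasRanks? v u i (i + + 1))
      (distinct Ω) (swapAt q p) (swapAt-injective q≢p) exchanged
    where
    adjacent : suc (toℕ p) ≡ toℕ q
    adjacent = consecutive-ranks rank-p rank-q
    q≢p : q ≢ p
    q≢p q≡p = ℕP.1+n≢n (trans adjacent (cong toℕ q≡p))
    -- Every ordering counted on the left carries u at p and v at q.
    exchanged : ∀ {σ} → σ ∈ toList (elems Ω) → HasRank σ u i × HasRank σ v (i + + 1) →
                swapAt q p σ ∈ toList (elems Ω) × HasRank (swapAt q p σ) v i × HasRank (swapAt q p σ) u (i + + 1)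
    exchanged {σ} σ∈ (u-rank′ , v-rank′) with satisfied u-rank′ | satisfied v-rank′
    ... | p′ , rank-p′ , σp′≡u | q′ , rank-q′ , σq′≡v
        with rank-injective (trans rank-p′ (sym rank-p)) | rank-injective (trans rank-q′ (sym rank-q))
    ... | refl | refl =
      initial-swap Ω v-initial σ∈ σq′≡v adjacent ,
      hasRank-intro (swapAt q p σ) p rank-p (trans (lookup-swapAtʳ q≢p σ) σq′≡v) ,
      hasRank-intro (swapAt q p σ) q rank-q (trans (lookup-swapAtˡ q p σ) σp′≡u)

lemma6 : ∀ {n : ℕ} (Ω : OrderingSet n) (x y : Fin n) → ¬ (x ≡ y) →
         Initial Ω x → Initial Ω y → (i : ℤ) →
         f Ω x y i (i + + 1) ≡ f Ω x y (i + + 1) i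
lemma6 Ω x y _ x-initial y-initial i =
  cong (λ m → + m / List⁺.length (elems Ω)) (ℕP.≤-antisym forward backward)
  where
  open ℕP.≤-Reasoning
  -- "x at i+1 and y at i" is "y at i and x at i+1" with the conjuncts swapped.
  reordered : count Ω (hasRanks? y x i (i + + 1)) ≡ count Ω (hasRanks? x y (i + + 1) i)
  reordered = cong length (ListP.filter-≐ (hasRanks? y x i (i + + 1)) (hasRanks? x y (i + + 1) i)
                             (Product.swap , Product.swap) (toList (elems Ω)))
  forward : count Ω (hasRanks? x y i (i + + 1)) ≤ count Ω (hasRanks? x y (i + + 1) i)
  forward = begin
    count Ω (hasRanks? x y i (i + + 1)) ≤⟨ exchange-≤ Ω x y y-initial i ⟩
    count Ω (hasRanks? y x i (i + + 1)) ≡⟨ reordered ⟩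
    count Ω (hasRanks? x y (i + + 1) i) ∎
  backward : count Ω (hasRanks? x y (i + + 1) i) ≤ count Ω (hasRanks? x y i (i + + 1))
  backward = begin
    count Ω (hasRanks? x y (i + + 1) i) ≡⟨ reordered ⟨
    count Ω (hasRanks? y x i (i + + 1)) ≤⟨ exchange-≤ Ω y x x-initial i ⟩
    count Ω (hasRanks? x y i (i + + 1)) ∎
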